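{- Let $G$ be a $\{K_4,\mathrm{wheel}\}$-free trigraph. Then either $G$ is diamond-free, or $G$ admits a clique-cutset, or $G$ admits a stable 2-cutset.
   Context: A trigraph $G$ is a finite set $V(G)$ with a function $\theta_G$ from 2-element subsets of $V(G)$ to $\{ -1,0,1\}$; distinct $u,v$ are strongly adjacent if $\theta_G(uv)=1$, semi-adjacent if $0$, strongly anti-adjacent if $-1$, adjacent if $\ge0$, anti-adjacent if $\le0$. A realization of $G$ is a graph on $V(G)$ obtained by turning each semi-adjacent pair into an edge or a non-edge (strongly adjacent pairs are edges, strongly anti-adjacent pairs non-edges); the full realization makes all semi-adjacent pairs edges. For a graph $H$, $G$ is $H$-free if no realization of $G$ contains $H$ as an induced subgraph; for a family, free of each member. A wheel is a chordless cycle together with a vertex having at least three neighbors on the cycle; the diamond is $K_4$ minus one edge. $G$ is connected if its full realization is connected; for $C\subseteq V(G)$, $G\setminus C$ is the induced subtrigraph on $V(G)\setminus C$. A cutset is a (possibly empty) set $C$ with $G\setminus C$ disconnected. A clique-cutset is a cutset whose vertices are pairwise strongly adjacent. A stable 2-cutset is a cutset consisting of two anti-adjacent vertices. -}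

module Defs where

open import Data.Nat using (ℕ; zero; suc; _≤_)
open import Data.Fin using (Fin; zero; suc; toℕ)
open import Data.Bool using (Bool; true; false)
open import Data.Product using (Σ; ∃; ∃-syntax; _×_; _,_)
open import Data.Sum using (_⊎_)
open import Relation.Nullary using (¬_)
open import Relation.Binary.PropositionalEquality using (_≡_; _≢_)
open import Function.Definitions using (Injective)

-- Value of θ: strong = 1, semi = 0, anti = -1.
data Adj : Set where
  strong semi anti : Adj

-- A trigraph on vertex set Fin n.  θ is a symmetric function; its values
-- on the diagonal are irrelevant (never used), so this is the same as a
-- function on 2-element subsets.
record Trigraph (n : ℕ) : Set where
  field
    θ   : Fin n → Fin n → Adj
    sym : ∀ u v → θ u v ≡ θ v u
open Trigraph public

-- A (simple) graph on Fin n given by its adjacency function (diagonal ignored).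
Graph : ℕ → Set
Graph n = Fin n → Fin n → Bool

record Realization {n : ℕ} (G : Trigraph n) : Set where
  field
    E      : Graph n
    E-sym  : ∀ u v → E u v ≡ E v u
    E-strong : ∀ u v → u ≢ v → θ G u v ≡ strong → E u v ≡ true
    E-anti   : ∀ u v → u ≢ v → θ G u v ≡ anti → E u v ≡ false
open Realization public

ContainsInduced : {n k : ℕ} → Graph n → Graph k → Set
ContainsInduced {n} {k} E H =
  Σ (Fin k → Fin n) λ f → Injective _≡_ _≡_ f ×
    (∀ i j → i ≢ j → E (f i) (f j) ≡ H i j)

Free : {n k : ℕ} → Trigraph n → Graph k → Set
Free G H = ¬ (Σ (Realization G) λ R → ContainsInduced (E R) H)

K4 : Graph 4
K4 _ _ = true

diamond : Graph 4
diamond zero (suc zero) = false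
diamond (suc zero) zero = false
diamond _ _ = true

CycAdj : {k : ℕ} → Fin k → Fin k → Set
CycAdj {k} i j =
  toℕ j ≡ suc (toℕ i) ⊎ toℕ i ≡ suc (toℕ j) ⊎
  (toℕ i ≡ 0 × suc (toℕ j) ≡ k) ⊎ (toℕ j ≡ 0 × suc (toℕ i) ≡ k)

ContainsWheel : {n : ℕ} → Graph n → Set
ContainsWheel {n} E =
  Σ ℕ λ k → 4 ≤ k × Σ (Fin k → Fin n) λ c → Injective _≡_ _≡_ c ×
    (∀ i j → i ≢ j → (E (c i) (c j) ≡ true → CycAdj i j) × (CycAdj i j → E (c i) (c j) ≡ true)) ×
    Σ (Fin n) λ x → (∀ i → c i ≢ x) ×
      Σ (Fin k) λ i₁ → Σ (Fin k) λ i₂ → Σ (Fin k) λ i₃ →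
        i₁ ≢ i₂ × i₁ ≢ i₃ × i₂ ≢ i₃ ×
        E x (c i₁) ≡ true × E x (c i₂) ≡ true × E x (c i₃) ≡ true

WheelFree : {n : ℕ} → Trigraph n → Set
WheelFree G = ¬ (Σ (Realization G) λ R → ContainsWheel (E R))

-- Adjacency in the full realization (semi-adjacent pairs are edges).
FullAdj : {n : ℕ} → Trigraph n → Fin n → Fin n → Set
FullAdj G u v = u ≢ v × θ G u v ≢ anti

data Reach {n : ℕ} (G : Trigraph n) (C : Fin n → Set) : Fin n → Fin n → Set where
  here : ∀ {u} → ¬ C u → Reach G C u u
  step : ∀ {u w v} → Reach G C u w → FullAdj G w v → ¬ C v → Reach G C u v

Cutset : {n : ℕ} → Trigraph n → (Fin n → Set) → Set
Cutset {n} G C = Σ (Fin n) λ u → Σ (Fin n) λ v → ¬ C u × ¬ C v × ¬ Reach G C u v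

-- A clique-cutset (C given by its characteristic function; may be empty): a cutset whose vertices are pairwise strongly adjacent.
HasCliqueCutset : {n : ℕ} → Trigraph n → Set
HasCliqueCutset {n} G = Σ (Fin n → Bool) λ C → Cutset G (λ v → C v ≡ true) ×
  (∀ u v → C u ≡ true → C v ≡ true → u ≢ v → θ G u v ≡ strong)

-- A stable 2-cutset: a cutset {a, b} with a ≠ b anti-adjacent (θ ≤ 0).
HasStable2Cutset : {n : ℕ} → Trigraph n → Set
HasStable2Cutset {n} G = Σ (Fin n) λ a → Σ (Fin n) λ b → a ≢ b ×
  θ G a b ≢ strong × Cutset G (λ v → v ≡ a ⊎ v ≡ b)

-- Work in the full realization of G (semi-adjacent pairs are
-- edges).  Either no four vertices a, b, c, d form a "diamond pattern"
-- (c ~ d and each of a, b adjacent to both c and d), and then no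
-- realization contains an induced diamond; or such a pattern exists.  In
-- that case {c, d} separates a from b: take an induced a–b path p₀ … p_m
-- avoiding c, d, and name {c, d} = {x, y} so that the first neighbour
-- p_(t+1) of y after p₀ comes no earlier than the first such neighbour
-- p_(s+1) of x.  If t = 0 then x, y, p₀, p₁ is a K₄; otherwise
-- y p₀ … p_(t+1) is a hole on which x has the three neighbours y, p₀ and
-- p_(s+1), a wheel.
-- So {c, d} is a clique-cutset if c, d are strongly adjacent and a stable
-- 2-cutset if they are semi-adjacent.
module Submission where

open import Defs hiding (sym)
open import Data.Nat using (ℕ; zero; suc; _+_; _≤_; _<_; z≤n; s≤s; _≤?_)
open import Data.Nat.Properties
  using (≤-refl; ≤-trans; ≤-pred; <⇒≤; ≤-total; <-cmp; 1+n≰n; n<1+n; m<n⇒m<1+n;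
         m≤n⇒m<n∨m≡n; m<1+n⇒m<n∨m≡n; 0≢1+n; suc-injective)
open import Data.Fin using (Fin; zero; suc; toℕ; fromℕ<; _≟_)
open import Data.Fin.Properties using (toℕ-injective; toℕ≤pred[n]; toℕ-fromℕ<; any?)
open import Data.Bool using (Bool; true; false)
import Data.Bool as Bool
open import Data.Bool.Properties using (¬-not)
open import Data.Product using (∃; _×_; _,_; proj₁; proj₂)
open import Data.Sum using (_⊎_; inj₁; inj₂; [_,_]′)
open import Data.Empty using (⊥; ⊥-elim)
open import Function using (_∘_; id; case_of_)
open import Function.Definitions using (Injective)
open import Relation.Binary.Definitions using (Symmetric; tri<; tri≈; tri>)
open import Relation.Binary.PropositionalEquality
  using (_≡_; _≢_; refl; sym; trans; cong; subst; subst₂)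
open import Relation.Nullary using (¬_; Dec; yes; no; does; ¬?; contradiction)
open import Relation.Nullary.Decidable using (_×-dec_; _⊎-dec_; dec-true)

not-both : ∀ {b} → b ≡ true → b ≡ false → ⊥
not-both refl ()

Minimal : (ℕ → Set) → ℕ → Set
Minimal P i = P i × (∀ {j} → j < i → ¬ P j)

search : {P : ℕ → Set} → (∀ i → Dec (P i)) → ∀ m →
         (∃ λ i → i < m × Minimal P i) ⊎ (∀ {j} → j < m → ¬ P j)
search P? zero = inj₂ λ ()
search P? (suc m) with search P? m
... | inj₁ (i , i<m , min) = inj₁ (i , m<n⇒m<1+n i<m , min)
... | inj₂ none with P? m
...   | yes Pm = inj₁ (m , n<1+n m , Pm , none)
...   | no ¬Pm = inj₂ λ j<1+m → case m<1+n⇒m<n∨m≡n j<1+m of λ where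
          (inj₁ j<m) → none j<m
          (inj₂ refl) → ¬Pm

least : {P : ℕ → Set} → (∀ i → Dec (P i)) → ∀ {m} → P m → ∃ λ i → i ≤ m × Minimal P i
least P? {m} Pm with search P? (suc m)
... | inj₁ (i , s≤s i≤m , min) = i , i≤m , min
... | inj₂ none = contradiction Pm (none (n<1+n m))

≤-suc-cases : ∀ {k i} → k ≤ suc i → k ≡ suc i ⊎ k ≤ i
≤-suc-cases k≤1+i with m≤n⇒m<n∨m≡n k≤1+i
... | inj₁ (s≤s k≤i) = inj₂ k≤i
... | inj₂ k≡1+i = inj₁ k≡1+i

Consecutive : ℕ → ℕ → Set
Consecutive i j = j ≡ suc i ⊎ i ≡ suc j

cyc-apex⇒ : ∀ {t} (i : Fin (suc t)) → CycAdj {suc (suc t)} zero (suc i) → toℕ i ≡ 0 ⊎ toℕ i ≡ t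
cyc-apex⇒ i (inj₁ eq) = inj₁ (suc-injective eq)
cyc-apex⇒ i (inj₂ (inj₁ ()))
cyc-apex⇒ i (inj₂ (inj₂ (inj₁ (_ , eq)))) = inj₂ (suc-injective (suc-injective eq))
cyc-apex⇒ i (inj₂ (inj₂ (inj₂ (() , _))))

cyc-apex⇐ : ∀ {t} (i : Fin (suc t)) → toℕ i ≡ 0 ⊎ toℕ i ≡ t → CycAdj {suc (suc t)} zero (suc i)
cyc-apex⇐ i (inj₁ eq) = inj₁ (cong suc eq)
cyc-apex⇐ i (inj₂ eq) = inj₂ (inj₂ (inj₁ (refl , cong (λ k → suc (suc k)) eq)))

-- Positions other than 0 are next to each other on the cycle exactly when
-- they are consecutive (the wrap-around always passes through 0).
cyc-inner⇒ : ∀ {k} (i j : Fin k) → CycAdj {suc k} (suc i) (suc j) → Consecutive (toℕ i) (toℕ j)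
cyc-inner⇒ i j (inj₁ eq) = inj₁ (suc-injective eq)
cyc-inner⇒ i j (inj₂ (inj₁ eq)) = inj₂ (suc-injective eq)
cyc-inner⇒ i j (inj₂ (inj₂ (inj₁ (() , _))))
cyc-inner⇒ i j (inj₂ (inj₂ (inj₂ (() , _))))

cyc-inner⇐ : ∀ {k} (i j : Fin k) → Consecutive (toℕ i) (toℕ j) → CycAdj {suc k} (suc i) (suc j)
cyc-inner⇐ i j (inj₁ eq) = inj₁ (cong suc eq)
cyc-inner⇐ i j (inj₂ eq) = inj₂ (inj₁ (cong suc eq))

CycAdj-sym : ∀ {k} {i j : Fin k} → CycAdj i j → CycAdj j i
CycAdj-sym (inj₁ eq) = inj₂ (inj₁ eq)
CycAdj-sym (inj₂ (inj₁ eq)) = inj₁ eq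
CycAdj-sym (inj₂ (inj₂ (inj₁ eqs))) = inj₂ (inj₂ (inj₂ eqs))
CycAdj-sym (inj₂ (inj₂ (inj₂ eqs))) = inj₂ (inj₂ (inj₁ eqs))

Pairwise4 : {A : Set} → (A → A → Set) → A → A → A → A → Set
Pairwise4 R w x y z = R w x × R w y × R w z × R x y × R x z × R y z

pairwise4? : {A : Set} {R : A → A → Set} → (∀ u v → Dec (R u v)) →
             ∀ w x y z → Dec (Pairwise4 R w x y z)
pairwise4? R? w x y z = R? w x ×-dec R? w y ×-dec R? w z ×-dec R? x y ×-dec R? x z ×-dec R? y z

quad : {A : Set} → A → A → A → A → Fin 4 → A
quad w x y z zero = w
quad w x y z (suc zero) = x
quad w x y z (suc (suc zero)) = y
quad w x y z (suc (suc (suc zero))) = z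

quad-pairwise : {A : Set} {R : A → A → Set} → Symmetric R → ∀ {w x y z} →
                Pairwise4 R w x y z → ∀ i j → i ≢ j → R (quad w x y z i) (quad w x y z j)
quad-pairwise {R = R} R-sym {w} {x} {y} {z} (wx , wy , wz , xy , xz , yz) = go
  where
  go : ∀ i j → i ≢ j → R (quad w x y z i) (quad w x y z j)
  go zero zero i≢j = contradiction refl i≢j
  go zero (suc zero) _ = wx
  go zero (suc (suc zero)) _ = wy
  go zero (suc (suc (suc zero))) _ = wz
  go (suc zero) zero _ = R-sym wx
  go (suc zero) (suc zero) i≢j = contradiction refl i≢j
  go (suc zero) (suc (suc zero)) _ = xy
  go (suc zero) (suc (suc (suc zero))) _ = xz
  go (suc (suc zero)) zero _ = R-sym wy
  go (suc (suc zero)) (suc zero) _ = R-sym xy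
  go (suc (suc zero)) (suc (suc zero)) i≢j = contradiction refl i≢j
  go (suc (suc zero)) (suc (suc (suc zero))) _ = yz
  go (suc (suc (suc zero))) zero _ = R-sym wz
  go (suc (suc (suc zero))) (suc zero) _ = R-sym xz
  go (suc (suc (suc zero))) (suc (suc zero)) _ = R-sym yz
  go (suc (suc (suc zero))) (suc (suc (suc zero))) i≢j = contradiction refl i≢j

quad-injective : {A : Set} {w x y z : A} → Pairwise4 _≢_ w x y z → Injective _≡_ _≡_ (quad w x y z)
quad-injective apart {i} {j} eq with i ≟ j
... | yes i≡j = i≡j
... | no i≢j = contradiction eq (quad-pairwise {R = _≢_} (λ u≢v v≡u → u≢v (sym v≡u)) apart i j i≢j)

does-true⇒ : {A : Set} (a? : Dec A) → does a? ≡ true → A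
does-true⇒ (yes a) _ = a
does-true⇒ (no _) ()

inPair : {n : ℕ} → Fin n → Fin n → Fin n → Bool
inPair c d v = does ((v ≟ c) ⊎-dec (v ≟ d))

inPair-sound : ∀ {n} {c d v : Fin n} → inPair c d v ≡ true → v ≡ c ⊎ v ≡ d
inPair-sound {c = c} {d} {v} = does-true⇒ ((v ≟ c) ⊎-dec (v ≟ d))

inPair-complete : ∀ {n} {c d v : Fin n} → v ≡ c ⊎ v ≡ d → inPair c d v ≡ true
inPair-complete {c = c} {d} {v} = dec-true ((v ≟ c) ⊎-dec (v ≟ d))

isAdjacent : Adj → Bool
isAdjacent anti = false
isAdjacent _ = true

isAdjacent-≢anti : ∀ t → t ≢ anti → isAdjacent t ≡ true
isAdjacent-≢anti strong _ = refl
isAdjacent-≢anti semi _ = refl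
isAdjacent-≢anti anti t≢anti = contradiction refl t≢anti

module _ {n : ℕ} (G : Trigraph n) where

  adj : Fin n → Fin n → Bool
  adj u v = isAdjacent (θ G u v)

  _~_ : Fin n → Fin n → Set
  u ~ v = adj u v ≡ true

  ~-sym : Symmetric _~_
  ~-sym {u} {v} u~v = trans (cong isAdjacent (Trigraph.sym G v u)) u~v

  fullRealization : Realization G
  fullRealization = record
    { E = adj
    ; E-sym = λ u v → cong isAdjacent (Trigraph.sym G u v)
    ; E-strong = λ _ _ _ → cong isAdjacent
    ; E-anti = λ _ _ _ → cong isAdjacent
    }

  realized⇒~ : (R : Realization G) → ∀ {u v} → u ≢ v → E R u v ≡ true → u ~ v
  realized⇒~ R {u} {v} u≢v uv∈R =
    isAdjacent-≢anti (θ G u v) λ uv-anti → not-both uv∈R (E-anti R u v u≢v uv-anti)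

  no-K4 : Free G K4 → ∀ {w x y z} → Pairwise4 _≢_ w x y z → Pairwise4 _~_ w x y z → ⊥
  no-K4 K4-free {w} {x} {y} {z} apart edges =
    K4-free (fullRealization , quad w x y z , quad-injective apart , quad-pairwise {R = _~_} ~-sym edges)

  cycleThrough : Fin n → (ℕ → Fin n) → ∀ {k} → Fin (suc k) → Fin n
  cycleThrough y p zero = y
  cycleThrough y p (suc i) = p (toℕ i)

  IsHole : ∀ {k} → (Fin k → Fin n) → Set
  IsHole c = Injective _≡_ _≡_ c ×
    (∀ i j → i ≢ j → (c i ~ c j → CycAdj i j) × (CycAdj i j → c i ~ c j))

  module _ (C : Fin n → Set) where

    record InducedPath (p : ℕ → Fin n) (m : ℕ) : Set where
      field
        distinct  : ∀ {i j} → i < j → j ≤ m → p i ≢ p j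
        linked    : ∀ {i} → suc i ≤ m → p i ~ p (suc i)
        chordless : ∀ {i j} → suc i < j → j ≤ m → adj (p i) (p j) ≡ false
        avoids    : ∀ {i} → i ≤ m → ¬ C (p i)
    open InducedPath

    record PathBetween (a b : Fin n) : Set where
      constructor path
      field
        vertex  : ℕ → Fin n
        length  : ℕ
        induced : InducedPath vertex length
        starts  : vertex 0 ≡ a
        ends    : vertex length ≡ b

    single : ∀ {a} → ¬ C a → InducedPath (λ _ → a) 0
    distinct (single _) i<j j≤0 = case ≤-trans i<j j≤0 of λ ()
    linked (single _) ()
    chordless (single _) 1+i<j j≤0 = case ≤-trans 1+i<j j≤0 of λ ()
    avoids (single ¬Ca) _ = ¬Ca

    prefix : ∀ {p m i} → InducedPath p m → i ≤ m → InducedPath p i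
    prefix P i≤m = record
      { distinct = λ j<k k≤i → distinct P j<k (≤-trans k≤i i≤m)
      ; linked = λ 1+j≤i → linked P (≤-trans 1+j≤i i≤m)
      ; chordless = λ 1+j<k k≤i → chordless P 1+j<k (≤-trans k≤i i≤m)
      ; avoids = λ j≤i → avoids P (≤-trans j≤i i≤m)
      }

    snoc : (ℕ → Fin n) → ℕ → Fin n → ℕ → Fin n
    snoc p i v j with j ≤? i
    ... | yes _ = p j
    ... | no _ = v

    snoc-old : ∀ p i v {j} → j ≤ i → snoc p i v j ≡ p j
    snoc-old p i v {j} j≤i with j ≤? i
    ... | yes _ = refl
    ... | no j≰i = contradiction j≤i j≰i

    snoc-new : ∀ p i v → snoc p i v (suc i) ≡ v
    snoc-new p i v with suc i ≤? i
    ... | yes 1+i≤i = contradiction 1+i≤i 1+n≰n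
    ... | no _ = refl

    snoc-induced : ∀ {p i v} → InducedPath p i → ¬ C v → (∀ {j} → j ≤ i → p j ≢ v) →
                   p i ~ v → (∀ {j} → j < i → adj (p j) v ≡ false) →
                   InducedPath (snoc p i v) (suc i)
    snoc-induced {p} {i} {v} P ¬Cv fresh last~v no-chord = record
      { distinct = distinct′ ; linked = linked′ ; chordless = chordless′ ; avoids = avoids′ }
      where
      q = snoc p i v
      old : ∀ {j} → j ≤ i → q j ≡ p j
      old = snoc-old p i v
      new : q (suc i) ≡ v
      new = snoc-new p i v

      distinct′ : ∀ {j k} → j < k → k ≤ suc i → q j ≢ q k
      distinct′ {j} j<k k≤1+i with ≤-suc-cases k≤1+i
      ... | inj₁ refl = λ eq → fresh (≤-pred j<k) (trans (sym (old (≤-pred j<k))) (trans eq new))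
      ... | inj₂ k≤i = λ eq →
            distinct P j<k k≤i (trans (sym (old (≤-trans (<⇒≤ j<k) k≤i))) (trans eq (old k≤i)))

      linked′ : ∀ {j} → suc j ≤ suc i → q j ~ q (suc j)
      linked′ 1+j≤1+i with m≤n⇒m<n∨m≡n (≤-pred 1+j≤1+i)
      ... | inj₁ j<i = subst₂ _~_ (sym (old (<⇒≤ j<i))) (sym (old j<i)) (linked P j<i)
      ... | inj₂ refl = subst₂ _~_ (sym (old ≤-refl)) (sym new) last~v

      chordless′ : ∀ {j k} → suc j < k → k ≤ suc i → adj (q j) (q k) ≡ false
      chordless′ {j} 1+j<k k≤1+i with ≤-suc-cases k≤1+i
      ... | inj₁ refl = subst₂ (λ a b → adj a b ≡ false) (sym (old j≤i)) (sym new) (no-chord (≤-pred 1+j<k))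
        where j≤i = <⇒≤ (≤-pred 1+j<k)
      ... | inj₂ k≤i = subst₂ (λ a b → adj a b ≡ false)
            (sym (old (≤-trans (<⇒≤ (<⇒≤ 1+j<k)) k≤i))) (sym (old k≤i)) (chordless P 1+j<k k≤i)

      avoids′ : ∀ {k} → k ≤ suc i → ¬ C (q k)
      avoids′ k≤1+i with ≤-suc-cases k≤1+i
      ... | inj₁ refl = ¬Cv ∘ subst C new
      ... | inj₂ k≤i = avoids P k≤i ∘ subst C (old k≤i)

    -- Stepping from the end of an induced path to a further vertex v ∉ C
    -- gives an induced path to v: cut back to the first vertex equal or
    -- adjacent to v, and append v if needed.
    extend : ∀ {a u v} → PathBetween a u → ¬ C v → u ~ v → PathBetween a v
    extend {v = v} (path p m P refl refl) ¬Cv last~v with least hits? (inj₂ last~v)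
      where
      hits? : ∀ j → Dec (p j ≡ v ⊎ p j ~ v)
      hits? j = (p j ≟ v) ⊎-dec (adj (p j) v Bool.≟ true)
    ... | i , i≤m , hit , before with p i ≟ v
    ...   | yes pᵢ≡v = path p i (prefix P i≤m) refl pᵢ≡v
    ...   | no pᵢ≢v =
            path (snoc p i v) (suc i) (snoc-induced (prefix P i≤m) ¬Cv fresh pᵢ~v no-chord) (snoc-old p i v z≤n) (snoc-new p i v)
      where
      fresh : ∀ {j} → j ≤ i → p j ≢ v
      fresh j≤i with m≤n⇒m<n∨m≡n j≤i
      ... | inj₁ j<i = before j<i ∘ inj₁
      ... | inj₂ refl = pᵢ≢v
      pᵢ~v : p i ~ v
      pᵢ~v = [ (λ pᵢ≡v → contradiction pᵢ≡v pᵢ≢v) , id ]′ hit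
      no-chord : ∀ {j} → j < i → adj (p j) v ≡ false
      no-chord j<i = ¬-not (before j<i ∘ inj₂)

    reach⇒path : ∀ {a b} → Reach G C a b → PathBetween a b
    reach⇒path {a} (here ¬Ca) = path (λ _ → a) 0 (single ¬Ca) refl refl
    reach⇒path (step r (_ , not-anti) ¬Cv) =
      extend (reach⇒path r) ¬Cv (isAdjacent-≢anti _ not-anti)

    path-injective : ∀ {p m i j} → InducedPath p m → i ≤ m → j ≤ m → p i ≡ p j → i ≡ j
    path-injective {i = i} {j} P i≤m j≤m eq with <-cmp i j
    ... | tri< i<j _ _ = contradiction eq (distinct P i<j j≤m)
    ... | tri≈ _ i≡j _ = i≡j
    ... | tri> _ _ j<i = contradiction (sym eq) (distinct P j<i i≤m)

    off-path : ∀ {p m v i} → InducedPath p m → C v → i ≤ m → v ≢ p i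
    off-path P Cv i≤m v≡pᵢ = avoids P i≤m (subst C v≡pᵢ Cv)

    forward-edge : ∀ {p m i j} → InducedPath p m → i < j → j ≤ m → p i ~ p j → j ≡ suc i
    forward-edge P i<j j≤m pᵢ~pⱼ with m≤n⇒m<n∨m≡n i<j
    ... | inj₁ 1+i<j = ⊥-elim (not-both pᵢ~pⱼ (chordless P 1+i<j j≤m))
    ... | inj₂ 1+i≡j = sym 1+i≡j

    edge⇒consecutive : ∀ {p m i j} → InducedPath p m → i ≢ j → i ≤ m → j ≤ m →
                       p i ~ p j → Consecutive i j
    edge⇒consecutive {i = i} {j} P i≢j i≤m j≤m pᵢ~pⱼ with <-cmp i j
    ... | tri< i<j _ _ = inj₁ (forward-edge P i<j j≤m pᵢ~pⱼ)
    ... | tri≈ _ i≡j _ = contradiction i≡j i≢j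
    ... | tri> _ _ j<i = inj₂ (forward-edge P j<i i≤m (~-sym pᵢ~pⱼ))

    consecutive⇒edge : ∀ {p m i j} → InducedPath p m → i ≤ m → j ≤ m →
                       Consecutive i j → p i ~ p j
    consecutive⇒edge P _ j≤m (inj₁ refl) = linked P j≤m
    consecutive⇒edge P i≤m _ (inj₂ refl) = ~-sym (linked P i≤m)

    close-hole : ∀ {p s y} → let t = suc (suc s) in
                 InducedPath p t → (∀ {j} → j ≤ t → y ≢ p j) → y ~ p 0 → y ~ p t →
                 (∀ {r} → r < suc s → ¬ y ~ p (suc r)) →
                 IsHole (cycleThrough y p {suc t})
    close-hole {p} {s} {y} P off first last inner = injective , edges
      where
      t = suc (suc s)
      bound : (i : Fin (suc t)) → toℕ i ≤ t
      bound = toℕ≤pred[n]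

      ends-only : ∀ {j} → j ≤ t → y ~ p j → j ≡ 0 ⊎ j ≡ t
      ends-only {zero} _ _ = inj₁ refl
      ends-only {suc r} 1+r≤t y~p with m≤n⇒m<n∨m≡n 1+r≤t
      ... | inj₁ 1+r<t = contradiction y~p (inner (≤-pred 1+r<t))
      ... | inj₂ 1+r≡t = inj₂ 1+r≡t

      ends : ∀ {j} → j ≡ 0 ⊎ j ≡ t → y ~ p j
      ends (inj₁ refl) = first
      ends (inj₂ refl) = last

      injective : Injective _≡_ _≡_ (cycleThrough y p)
      injective {zero} {zero} _ = refl
      injective {zero} {suc j} eq = contradiction eq (off (bound j))
      injective {suc i} {zero} eq = contradiction (sym eq) (off (bound i))
      injective {suc i} {suc j} eq = cong suc (toℕ-injective (path-injective P (bound i) (bound j) eq))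

      apex-edges : ∀ i → (y ~ p (toℕ i) → CycAdj zero (suc i)) × (CycAdj zero (suc i) → y ~ p (toℕ i))
      apex-edges i = cyc-apex⇐ i ∘ ends-only (bound i) , ends ∘ cyc-apex⇒ i

      edges : ∀ i j → i ≢ j → (cycleThrough y p i ~ cycleThrough y p j → CycAdj i j) ×
                                (CycAdj i j → cycleThrough y p i ~ cycleThrough y p j)
      edges zero zero i≢j = contradiction refl i≢j
      edges zero (suc j) _ = apex-edges j
      edges (suc i) zero _ =
        (λ h → CycAdj-sym (proj₁ (apex-edges i) (~-sym h))) , (λ c → ~-sym (proj₂ (apex-edges i) (CycAdj-sym c)))
      edges (suc i) (suc j) i≢j =
        cyc-inner⇐ i j ∘ edge⇒consecutive P (i≢j ∘ cong suc ∘ toℕ-injective) (bound i) (bound j) ,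
        consecutive⇒edge P (bound i) (bound j) ∘ cyc-inner⇒ i j

    module _ (K4-free : Free G K4) (wheel-free : WheelFree G) where

      -- x, y ∈ C adjacent to each other and to the start of an induced path
      -- of G ∖ C, such that y's first neighbour after p 0 is p (ty + 1) and
      -- x has a neighbour p (tx + 1) no later: this yields a K₄ (ty = 0) or a
      -- wheel (the hole y p 0 … p (ty + 1) with centre x).
      fan : ∀ {p m x y} → InducedPath p (suc m) → C x → C y → x ≢ y → x ~ y →
            x ~ p 0 → y ~ p 0 → ∀ {tx ty} → tx ≤ ty → ty ≤ m →
            x ~ p (suc tx) → y ~ p (suc ty) → (∀ {s} → s < ty → ¬ y ~ p (suc s)) → ⊥
      fan P Cx Cy x≢y x~y x~p₀ y~p₀ {ty = zero} z≤n _ x~p₁ y~p₁ _ =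
        no-K4 K4-free
          (x≢y , off-path P Cx z≤n , off-path P Cx 1≤ , off-path P Cy z≤n , off-path P Cy 1≤ , distinct P 1≤ 1≤)
          (x~y , x~p₀ , x~p₁ , y~p₀ , y~p₁ , linked P 1≤)
        where
        1≤ : ∀ {k} → 1 ≤ suc k
        1≤ = s≤s z≤n
      fan {p} {m} {x} {y} P Cx Cy x≢y x~y x~p₀ y~p₀ {tx} {suc s} tx≤ty ty≤m x~pₓ y~pᵧ inner =
        wheel-free (fullRealization , wheel)
        where
        hole : IsHole (cycleThrough y p {suc (suc (suc s))})
        hole = close-hole (prefix P (s≤s ty≤m)) (λ j≤ → off-path P Cy (≤-trans j≤ (s≤s ty≤m))) y~p₀ y~pᵧ inner
        -- the position of p (tx + 1) on the cycle
        iₓ : Fin (suc (suc (suc s)))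
        iₓ = fromℕ< (s≤s (s≤s tx≤ty))
        off-cycle : ∀ i → cycleThrough y p i ≢ x
        off-cycle zero = x≢y ∘ sym
        off-cycle (suc i) = off-path P Cx (≤-trans (toℕ≤pred[n] i) (s≤s ty≤m)) ∘ sym
        apart : suc {3 + s} zero ≢ suc iₓ
        apart eq = 0≢1+n (trans (suc-injective (cong toℕ eq)) (toℕ-fromℕ< (s≤s (s≤s tx≤ty))))
        wheel : ContainsWheel adj
        wheel = 4 + s , s≤s (s≤s (s≤s (s≤s z≤n))) , cycleThrough y p , proj₁ hole , proj₂ hole ,
                x , off-cycle , zero , suc zero , suc iₓ , (λ ()) , (λ ()) , apart ,
                x~y , x~p₀ , subst (λ j → x ~ p j) (sym (toℕ-fromℕ< (s≤s (s≤s tx≤ty)))) x~pₓ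

      separated : ∀ {a b c d} → C c → C d → c ≢ d → c ~ d →
                  c ~ a → d ~ a → c ~ b → d ~ b → a ≢ b → ¬ Reach G C a b
      separated {c = c} {d} Cc Cd c≢d c~d c~a d~a c~b d~b a≢b r with reach⇒path r
      ... | path p zero _ refl refl = a≢b refl
      ... | path p (suc m) P refl refl with least (next? c) c~b | least (next? d) d~b
        where
        next? : ∀ x j → Dec (x ~ p (suc j))
        next? x j = adj x (p (suc j)) Bool.≟ true
      ... | tc , tc≤m , c~next , c-before | td , td≤m , d~next , d-before with ≤-total tc td
      ...   | inj₁ tc≤td = fan P Cc Cd c≢d c~d c~a d~a tc≤td td≤m c~next d~next d-before
      ...   | inj₂ td≤tc = fan P Cd Cc (c≢d ∘ sym) (~-sym c~d) d~a c~a td≤tc tc≤m d~next c~next c-before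

  DiamondPattern : Fin n → Fin n → Fin n → Fin n → Set
  DiamondPattern a b c d = Pairwise4 _≢_ a b c d × c ~ d × a ~ c × a ~ d × b ~ c × b ~ d

  diamondPattern? : ∀ a b c d → Dec (DiamondPattern a b c d)
  diamondPattern? a b c d =
    pairwise4? (λ u v → ¬? (u ≟ v)) a b c d ×-dec c ~? d ×-dec a ~? c ×-dec a ~? d ×-dec b ~? c ×-dec b ~? d
    where
    _~?_ : ∀ u v → Dec (u ~ v)
    u ~? v = adj u v Bool.≟ true

  diamond-or-pattern : Free G diamond ⊎ ∃ λ a → ∃ λ b → ∃ λ c → ∃ λ d → DiamondPattern a b c d
  diamond-or-pattern with any? (λ a → any? (λ b → any? (λ c → any? (λ d → diamondPattern? a b c d))))
  ... | yes found = inj₂ found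
  ... | no none = inj₁ λ (R , f , f-inj , f-induces) → none (embedded-pattern R f f-inj f-induces)
    where
    0F 1F 2F 3F : Fin 4
    0F = zero
    1F = suc zero
    2F = suc (suc zero)
    3F = suc (suc (suc zero))
    embedded-pattern : (R : Realization G) (f : Fin 4 → Fin n) → Injective _≡_ _≡_ f →
              (∀ i j → i ≢ j → E R (f i) (f j) ≡ diamond i j) →
              ∃ λ a → ∃ λ b → ∃ λ c → ∃ λ d → DiamondPattern a b c d
    embedded-pattern R f f-inj f-induces =
      f 0F , f 1F , f 2F , f 3F ,
      (apart (λ ()) , apart (λ ()) , apart (λ ()) , apart (λ ()) , apart (λ ()) , apart (λ ())) ,
      edge 2F 3F (λ ()) refl , edge 0F 2F (λ ()) refl , edge 0F 3F (λ ()) refl ,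
      edge 1F 2F (λ ()) refl , edge 1F 3F (λ ()) refl
      where
      apart : ∀ {i j} → i ≢ j → f i ≢ f j
      apart i≢j = i≢j ∘ f-inj
      edge : ∀ i j → i ≢ j → diamond i j ≡ true → f i ~ f j
      edge i j i≢j ij∈diamond = realized⇒~ R (apart i≢j) (trans (f-induces i j i≢j) ij∈diamond)

  middle-cutset : Free G K4 → WheelFree G → ∀ {a b c d} (C : Fin n → Set) →
                  C c → C d → (∀ {v} → C v → v ≡ c ⊎ v ≡ d) → DiamondPattern a b c d → Cutset G C
  middle-cutset K4-free wheel-free {a} {b} {c} {d} C Cc Cd only
    ((a≢b , a≢c , a≢d , b≢c , b≢d , c≢d) , c~d , a~c , a~d , b~c , b~d) =
    a , b , outside a≢c a≢d , outside b≢c b≢d ,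
    separated C K4-free wheel-free Cc Cd c≢d c~d (~-sym a~c) (~-sym a~d) (~-sym b~c) (~-sym b~d) a≢b
    where
    outside : ∀ {v} → v ≢ c → v ≢ d → ¬ C v
    outside v≢c v≢d Cv = [ v≢c , v≢d ]′ (only Cv)

  strong-pair : ∀ {c d} → θ G c d ≡ strong →
                ∀ u v → u ≡ c ⊎ u ≡ d → v ≡ c ⊎ v ≡ d → u ≢ v → θ G u v ≡ strong
  strong-pair _ u v (inj₁ refl) (inj₁ refl) u≢v = contradiction refl u≢v
  strong-pair cd-strong u v (inj₁ refl) (inj₂ refl) _ = cd-strong
  strong-pair cd-strong u v (inj₂ refl) (inj₁ refl) _ = trans (Trigraph.sym G u v) cd-strong
  strong-pair _ u v (inj₂ refl) (inj₂ refl) u≢v = contradiction refl u≢v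

  diamond-cutset : Free G K4 → WheelFree G → ∀ {a b c d} → DiamondPattern a b c d →
                   HasCliqueCutset G ⊎ HasStable2Cutset G
  diamond-cutset K4-free wheel-free {c = c} {d} shape@((_ , _ , _ , _ , _ , c≢d) , c~d , _) =
    by-middle-edge (θ G c d) refl
    where
    by-middle-edge : ∀ t → θ G c d ≡ t → HasCliqueCutset G ⊎ HasStable2Cutset G
    by-middle-edge strong θcd = inj₁ (inPair c d ,
      middle-cutset K4-free wheel-free (λ v → inPair c d v ≡ true)
        (inPair-complete {c = c} {d} (inj₁ refl)) (inPair-complete {c = c} {d} (inj₂ refl)) inPair-sound shape ,
      λ u v u∈C v∈C → strong-pair θcd u v (inPair-sound u∈C) (inPair-sound v∈C))
    by-middle-edge semi θcd = inj₂ (c , d , c≢d , (λ cd-strong → case trans (sym θcd) cd-strong of λ ()) ,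
      middle-cutset K4-free wheel-free (λ v → v ≡ c ⊎ v ≡ d) (inj₁ refl) (inj₂ refl) id shape)
    by-middle-edge anti θcd = ⊥-elim (not-both c~d (cong isAdjacent θcd))

proposition4p3 : (n : ℕ) (G : Trigraph n) → Free G K4 → WheelFree G →
    Free G diamond ⊎ HasCliqueCutset G ⊎ HasStable2Cutset G
proposition4p3 n G K4-free wheel-free with diamond-or-pattern G
... | inj₁ diamond-free = inj₁ diamond-free
... | inj₂ (_ , _ , _ , _ , found) = inj₂ (diamond-cutset G K4-free wheel-free found)
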